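{- Let $n \in \mathbb{Z}_{\ge 0}$. Then the set $\{F_i F_j ;\ i,j \in \mathbb{Z}_{\ge 0},\ i+j = n\}$ has cardinality $\lceil \frac{n+1}{2} \rceil$, and for every $m \in \{1, \dotsc, \lceil \frac{n+1}{2} \rceil\}$ the $m$th smallest element of this set is $F_{2m-2-c}\, F_{n-(2m-2-c)}$, where $c = 0$ if $m \le \lfloor \frac{n+4}{4} \rfloor$ or $n$ is odd, and $c = 1$ if $m > \lfloor \frac{n+4}{4} \rfloor$ and $n$ is even.
   Context: $F_n$ denotes the $n$th Fibonacci number, defined for all $n\in\mathbb{Z}$ by $F_0=0$, $F_1=1$, $F_n=F_{n-1}+F_{n-2}$. -}

module Defs where

open import Data.Nat using (ℕ; zero; suc; _+_; _*_; _∸_; _≤ᵇ_; _%_; _/_; ⌈_/2⌉)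
open import Data.Nat.DivMod
open import Data.Bool using (Bool; true; false; if_then_else_; _∨_)
open import Data.Product using (Σ; ∃; _×_; _,_)
open import Relation.Binary.PropositionalEquality using (_≡_)

fib : ℕ → ℕ
fib zero = 0
fib (suc zero) = 1
fib (suc (suc n)) = fib (suc n) + fib n

InProdSet : ℕ → ℕ → Set
InProdSet n x = Σ ℕ λ i → Σ ℕ λ j → (i + j ≡ n) × (fib i * fib j ≡ x)

card : ℕ → ℕ
card n = ⌈ suc n /2⌉

isOdd : ℕ → Bool
isOdd n = n % 2 ≡ᵇ' 1
  where
  open import Data.Nat using () renaming (_≡ᵇ_ to _≡ᵇ'_)

cc : ℕ → ℕ → ℕ
cc n m = if (m ≤ᵇ ((n + 4) / 4)) ∨ isOdd n then 0 else 1

-- the claimed m-th smallest element F_{2m-2-c} F_{n-(2m-2-c)}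
-- (for 1 ≤ m ≤ card n the index 2m-2-c lies in [0, n], so ∸ is exact)
elt : ℕ → ℕ → ℕ
elt n m = fib (2 * m ∸ 2 ∸ cc n m) * fib (n ∸ (2 * m ∸ 2 ∸ cc n m))

-- Vajda's identity F_{k+i} F_{k+d} − F_k F_{k+i+d} = (−1)^k F_i F_d, which reduces to Cassini's
-- identity because both sides satisfy the Fibonacci recurrence in i and in d, compares two
-- products F_x F_y and F_u F_v with x + y = u + v: if x is the smallest of the four indices, then
-- F_x F_y is the smaller product exactly when x is even. Among the pairs x ≤ y with x + y = n the
-- products therefore increase along the even x = 0, 2, 4, … and then along the odd x taken
-- downwards. The formula F_{2m−2−c} F_{n−(2m−2−c)} lists the pairs in exactly this order: for
-- 4(m − 1) ≤ n its smaller index is the even 2m − 2, and for the remaining m it is the odd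
-- 2(⌈(n+1)/2⌉ − m) + 1.
module Submission where

open import Defs
open import Algebra.Properties.CommutativeSemigroup using (interchange)
open import Data.Bool using (Bool; true; false; not; T)
open import Data.Bool.Properties using (∨-zeroʳ)
open import Data.Nat
  using (ℕ; zero; suc; _+_; _*_; _∸_; _≤_; _<_; _≤ᵇ_; _≡ᵇ_; _/_; _%_; ⌊_/2⌋; s≤s; z≤n; s≤s⁻¹)
open import Data.Nat.DivMod using (m*n/n≡m; /-monoˡ-≤; m<n*o⇒m/o<n; m*n%n≡0; [m+kn]%n≡m%n)
open import Data.Nat.Properties
open import Data.Nat.Tactic.RingSolver using (solve-∀)
open import Data.Product using (Σ; ∃; _×_; _,_; proj₁; proj₂)
open import Data.Sum using (inj₁; inj₂)
open import Data.Unit using (tt)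
open import Data.Empty using (⊥-elim)
open import Function.Bundles using (_⇔_; mk⇔)
open import Relation.Binary.PropositionalEquality
open import Relation.Nullary using (yes; no; contradiction)

record FibLike (f : ℕ → ℕ) : Set where
  constructor fibLike
  field recurrence : ∀ n → f (suc (suc n)) ≡ f (suc n) + f n

open FibLike

fibLike-fib : FibLike fib
fibLike-fib = fibLike λ n → refl

fibLike-shift : ∀ {f} k → FibLike f → FibLike (λ n → f (n + k))
fibLike-shift k f-rec = fibLike λ n → recurrence f-rec (n + k)

fibLike-scale : ∀ {f} c → FibLike f → FibLike (λ n → c * f n)
fibLike-scale {f} c f-rec = fibLike λ n →
  trans (cong (c *_) (recurrence f-rec n)) (*-distribˡ-+ c (f (suc n)) (f n))

isEven : ℕ → Bool
isEven zero = true
isEven (suc n) = not (isEven n)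

-- Gap s a b c encodes a − b = c when s is true and a − b = −c when s is false.
Gap : Bool → ℕ → ℕ → ℕ → Set
Gap true  a b c = a ≡ b + c
Gap false a b c = b ≡ a + c

gap-resp : ∀ s {a a′ b b′ c c′} → a ≡ a′ → b ≡ b′ → c ≡ c′ →
  Gap s a b c → Gap s a′ b′ c′
gap-resp s refl refl refl g = g

gap-at : ∀ {s s′ a b c} → s ≡ s′ → Gap s a b c → Gap s′ a b c
gap-at refl g = g

gap-+ : ∀ s {a b c a′ b′ c′} → Gap s a b c → Gap s a′ b′ c′ →
  Gap s (a + a′) (b + b′) (c + c′)
gap-+ true  {b = b} {c} {b′ = b′} {c′} refl refl = interchange +-commutativeSemigroup b c b′ c′
gap-+ false {a} {c = c} {a′} {c′ = c′} refl refl = interchange +-commutativeSemigroup a c a′ c′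

gap-flip : ∀ s {a b c} x → Gap s a b c → Gap (not s) (x + b) (x + a) c
gap-flip true  {b = b} {c} x refl = sym (+-assoc x b c)
gap-flip false {a} {c = c} x refl = sym (+-assoc x a c)

gap-swap : ∀ s x y → Gap s (x * y) (y * x) 0
gap-swap true  x y = trans (*-comm x y) (sym (+-identityʳ (y * x)))
gap-swap false x y = trans (*-comm y x) (sym (+-identityʳ (x * y)))

gap-fibLike : ∀ s {a b c} → FibLike a → FibLike b → FibLike c →
  Gap s (a 0) (b 0) (c 0) → Gap s (a 1) (b 1) (c 1) → ∀ n → Gap s (a n) (b n) (c n)
gap-fibLike s {a} {b} {c} a-rec b-rec c-rec g₀ g₁ = go
  where
  go : ∀ n → Gap s (a n) (b n) (c n)
  go zero = g₀
  go (suc zero) = g₁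
  go (suc (suc n)) =
    gap-resp s (sym (recurrence a-rec n)) (sym (recurrence b-rec n)) (sym (recurrence c-rec n))
      (gap-+ s (go (suc n)) (go n))

cassini : ∀ k → Gap (isEven k) (fib (suc k) * fib (suc k)) (fib k * fib (suc (suc k))) 1
cassini zero = refl
cassini (suc k) =
  gap-resp (not (isEven k)) (sym (*-distribʳ-+ F₂ F₁ F₀)) (sym (*-distribˡ-+ F₁ F₂ F₁)) refl
    (gap-flip (isEven k) (F₁ * F₂) (cassini k))
  where
  F₀ = fib k
  F₁ = fib (suc k)
  F₂ = fib (suc (suc k))

dOcagne : ∀ k i → Gap (isEven k) (fib (suc k) * fib (i + k)) (fib k * fib (i + suc k)) (fib 1 * fib i)
dOcagne k = gap-fibLike (isEven k)
  (fibLike-scale (fib (suc k)) (fibLike-shift k fibLike-fib))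
  (fibLike-scale (fib k) (fibLike-shift (suc k) fibLike-fib))
  (fibLike-scale 1 fibLike-fib)
  (gap-swap (isEven k) (fib (suc k)) (fib k))
  (cassini k)

vajda : ∀ k i d → Gap (isEven k) (fib (i + k) * fib (d + k)) (fib k * fib (d + (i + k))) (fib i * fib d)
vajda k i = gap-fibLike (isEven k)
  (fibLike-scale (fib (i + k)) (fibLike-shift k fibLike-fib))
  (fibLike-scale (fib k) (fibLike-shift (i + k) fibLike-fib))
  (fibLike-scale (fib i) fibLike-fib)
  (gap-resp (isEven k) refl refl (sym (*-zeroʳ (fib i))) (gap-swap (isEven k) (fib (i + k)) (fib k)))
  (gap-resp (isEven k) (*-comm (fib (suc k)) (fib (i + k))) (cong (λ j → fib k * fib j) (+-suc i k))
     (*-comm (fib 1) (fib i)) (dOcagne k i))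

fib-pos : ∀ n → 0 < fib (suc n)
fib-pos zero = s≤s z≤n
fib-pos (suc n) = ≤-trans (fib-pos n) (m≤m+n (fib (suc n)) (fib n))

gap-true-< : ∀ {a b c} → Gap true a b c → 0 < c → b < a
gap-true-< {b = b} refl c>0 = m<m+n b c>0

gap-false-< : ∀ {a b c} → Gap false a b c → 0 < c → a < b
gap-false-< {a} refl c>0 = m<m+n a c>0

-- Vajda's identity with k = x, i = u − x, d = v − x.
fib*-gap : ∀ {x y u v} → x < u → x < v → x + y ≡ u + v →
  ∃ λ c → 0 < c × Gap (isEven x) (fib u * fib v) (fib x * fib y) c
fib*-gap {x} {y} x<u x<v eq with m≤n⇒∃[o]m+o≡n x<u | m≤n⇒∃[o]m+o≡n x<v
... | i , refl | d , refl =
  fib (suc i) * fib (suc d) ,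
  *-mono-≤ (fib-pos i) (fib-pos d) ,
  gap-resp (isEven x) (cong₂ (λ p q → fib (suc p) * fib (suc q)) (+-comm i x) (+-comm d x))
    (cong (λ j → fib x * fib j) y≡) refl (vajda x (suc i) (suc d))
  where
  rearrange : ∀ x i d → x + (suc d + (suc i + x)) ≡ suc x + i + (suc x + d)
  rearrange = solve-∀
  y≡ : suc d + (suc i + x) ≡ y
  y≡ = +-cancelˡ-≡ x _ _ (trans (rearrange x i d) (sym eq))

data EvenOrOdd : ℕ → Set where
  even : ∀ h → EvenOrOdd (2 * h)
  odd  : ∀ h → EvenOrOdd (suc (2 * h))

evenOrOdd : ∀ n → EvenOrOdd n
evenOrOdd zero = even 0
evenOrOdd (suc n) with evenOrOdd n
... | even h = odd h
... | odd h = subst EvenOrOdd (*-suc 2 h) (even (suc h))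

isEven-double : ∀ h → isEven (2 * h) ≡ true
isEven-double zero = refl
isEven-double (suc h) = trans (cong isEven (*-suc 2 h)) (cong (λ b → not (not b)) (isEven-double h))

fib*-<-even : ∀ h {y u v} → 2 * h < u → 2 * h < v → 2 * h + y ≡ u + v →
  fib (2 * h) * fib y < fib u * fib v
fib*-<-even h x<u x<v eq with fib*-gap x<u x<v eq
... | c , c>0 , gap = gap-true-< (gap-at (isEven-double h) gap) c>0

fib*-<-odd : ∀ h {y u v} → suc (2 * h) < u → suc (2 * h) < v → suc (2 * h) + y ≡ u + v →
  fib u * fib v < fib (suc (2 * h)) * fib y
fib*-<-odd h x<u x<v eq with fib*-gap x<u x<v eq
... | c , c>0 , gap = gap-false-< (gap-at (cong not (isEven-double h)) gap) c>0

even<odd : ∀ {t s} → t ≤ s → 2 * t < suc (2 * s)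
even<odd t≤s = s≤s (*-monoʳ-≤ 2 t≤s)

odd<even : ∀ {s t} → s < t → suc (2 * s) < 2 * t
odd<even {s} {t} s<t = subst (_≤ 2 * t) (*-suc 2 s) (*-monoʳ-≤ 2 s<t)

card-+2* : ∀ n s → card (n + 2 * s) ≡ card n + s
card-+2* n zero = trans (cong card (+-identityʳ n)) (sym (+-identityʳ (card n)))
card-+2* n (suc s) = begin
  card (n + 2 * suc s)      ≡⟨ cong card (shift n s) ⟩
  suc (card (n + 2 * s))    ≡⟨ cong suc (card-+2* n s) ⟩
  suc (card n + s)          ≡⟨ sym (+-suc (card n) s) ⟩
  card n + suc s            ∎
  where
  open ≡-Reasoning
  shift : ∀ n s → n + 2 * suc s ≡ suc (suc (n + 2 * s))
  shift = solve-∀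

<-card : ∀ {a n} → 2 * a ≤ n → a < card n
<-card {a} h with m≤n⇒∃[o]m+o≡n h
... | r , refl = subst (a <_) (sym (trans (cong card (+-comm (2 * a) r)) (card-+2* r a)))
                   (s≤s (m≤n+m a ⌊ r /2⌋))

double-⌊/2⌋≤ : ∀ n → 2 * ⌊ n /2⌋ ≤ n
double-⌊/2⌋≤ zero = z≤n
double-⌊/2⌋≤ (suc zero) = z≤n
double-⌊/2⌋≤ (suc (suc n)) =
  subst (_≤ suc (suc n)) (sym (*-suc 2 ⌊ n /2⌋)) (s≤s (s≤s (double-⌊/2⌋≤ n)))

isOdd-double : ∀ h → isOdd (2 * h) ≡ false
isOdd-double h = cong (_≡ᵇ 1) (trans (cong (_% 2) (*-comm 2 h)) (m*n%n≡0 h 2))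

isOdd-suc-double : ∀ h → isOdd (suc (2 * h)) ≡ true
isOdd-suc-double h = cong (_≡ᵇ 1) (trans (cong (λ k → suc k % 2) (*-comm 2 h)) ([m+kn]%n≡m%n 1 h 2))

cc-≤ : ∀ {n m} → m * 4 ≤ n + 4 → cc n m ≡ 0
cc-≤ {n} {m} h with m ≤ᵇ (n + 4) / 4 in le
... | true = refl
... | false = ⊥-elim (subst T le (≤⇒≤ᵇ m≤))
  where
  m≤ : m ≤ (n + 4) / 4
  m≤ = subst (_≤ (n + 4) / 4) (m*n/n≡m m 4) (/-monoˡ-≤ 4 h)

cc-> : ∀ {n m} → n + 4 < m * 4 → isOdd n ≡ false → cc n m ≡ 1
cc-> {n} {m} h n-even with m ≤ᵇ (n + 4) / 4 in le
... | true = contradiction (≤ᵇ⇒≤ m _ (subst T (sym le) tt)) (<⇒≱ (m<n*o⇒m/o<n h))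
... | false rewrite n-even = refl

cc-odd : ∀ {n m} → isOdd n ≡ true → cc n m ≡ 0
cc-odd {n} {m} n-odd rewrite n-odd | ∨-zeroʳ (m ≤ᵇ (n + 4) / 4) = refl

index : ℕ → ℕ → ℕ
index n m = 2 * m ∸ 2 ∸ cc n m

index-≤ : ∀ {n m} → m ≤ card n → index n m ≤ n
index-≤ {n} {m} m≤card = begin
  index n m           ≤⟨ m∸n≤m (2 * m ∸ 2) (cc n m) ⟩
  2 * m ∸ 2           ≤⟨ ∸-monoˡ-≤ 2 (*-monoʳ-≤ 2 m≤card) ⟩
  2 * card n ∸ 2      ≡⟨ cong (_∸ 2) (*-suc 2 ⌊ n /2⌋) ⟩
  2 * ⌊ n /2⌋         ≤⟨ double-⌊/2⌋≤ n ⟩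
  n                   ∎
  where open ≤-Reasoning

elt-index : ∀ {n m i j} → index n m ≡ i → i + j ≡ n → elt n m ≡ fib i * fib j
elt-index {i = i} {j} eq refl rewrite eq | m+n∸m≡n i j = refl

index-lower : ∀ {n t} → cc n (suc t) ≡ 0 → index n (suc t) ≡ 2 * t
index-lower {t = t} c≡0 = trans (cong (2 * suc t ∸ 2 ∸_) c≡0) (cong (_∸ 2) (*-suc 2 t))

index-upper : ∀ {n t} → cc n (suc (suc t)) ≡ 1 → index n (suc (suc t)) ≡ suc (2 * t)
index-upper {t = t} c≡1 =
  trans (cong (2 * suc (suc t) ∸ 2 ∸_) c≡1) (cong (λ k → k ∸ 2 ∸ 1) (double-2+ t))
  where
  double-2+ : ∀ t → 2 * suc (suc t) ≡ 3 + suc (2 * t)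
  double-2+ = solve-∀

elt-lower : ∀ {n} t y → 2 * t + y ≡ n → 2 * t ≤ y → elt n (suc t) ≡ fib (2 * t) * fib y
elt-lower {n} t y eq 2t≤y = elt-index {n} {suc t} (index-lower {n} (cc-≤ bound)) eq
  where
  open ≤-Reasoning
  quadruple : ∀ t → suc t * 4 ≡ 2 * t + 2 * t + 4
  quadruple = solve-∀
  bound : suc t * 4 ≤ n + 4
  bound = begin
    suc t * 4           ≡⟨ quadruple t ⟩
    2 * t + 2 * t + 4   ≤⟨ +-monoˡ-≤ 4 (+-monoʳ-≤ (2 * t) 2t≤y) ⟩
    2 * t + y + 4       ≡⟨ cong (_+ 4) eq ⟩
    n + 4               ∎

card-upper : ∀ {n} s y → suc (2 * s) + y ≡ n → card n ∸ s ≡ card (suc y)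
card-upper s y refl = begin
  card (suc (2 * s) + y) ∸ s   ≡⟨ cong (λ k → card k ∸ s) (swap s y) ⟩
  card (suc y + 2 * s) ∸ s     ≡⟨ cong (_∸ s) (card-+2* (suc y) s) ⟩
  card (suc y) + s ∸ s         ≡⟨ m+n∸n≡m (card (suc y)) s ⟩
  card (suc y)                 ∎
  where
  open ≡-Reasoning
  swap : ∀ s y → suc (2 * s) + y ≡ suc y + 2 * s
  swap = solve-∀

cc-upper : ∀ s b → s ≤ b → cc (suc (2 * s) + suc (2 * b)) (suc (suc b)) ≡ 1
cc-upper s b s≤b = cc-> {suc (2 * s) + suc (2 * b)} {suc (suc b)} bound
  (trans (cong isOdd (halve s b)) (isOdd-double (suc (s + b))))
  where
  open ≤-Reasoning
  halve : ∀ s b → suc (2 * s) + suc (2 * b) ≡ 2 * suc (s + b)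
  halve = solve-∀
  reassoc : ∀ s b → suc (2 * s) + suc (2 * b) + 4 ≡ 2 * s + (2 * b + 6)
  reassoc = solve-∀
  quadruple : ∀ b → 2 * b + (2 * b + 6) + 2 ≡ suc (suc b) * 4
  quadruple = solve-∀
  bound : suc (2 * s) + suc (2 * b) + 4 < suc (suc b) * 4
  bound = begin-strict
    suc (2 * s) + suc (2 * b) + 4  ≡⟨ reassoc s b ⟩
    2 * s + (2 * b + 6)            ≤⟨ +-monoˡ-≤ (2 * b + 6) (*-monoʳ-≤ 2 s≤b) ⟩
    2 * b + (2 * b + 6)            <⟨ m<m+n _ (s≤s z≤n) ⟩
    2 * b + (2 * b + 6) + 2        ≡⟨ quadruple b ⟩
    suc (suc b) * 4                ∎

elt-upper : ∀ {n} s y → suc (2 * s) + y ≡ n → suc (2 * s) ≤ y →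
  elt n (card n ∸ s) ≡ fib (suc (2 * s)) * fib y
elt-upper s y refl x≤y with evenOrOdd y
... | even b = begin
  elt n (card n ∸ s)              ≡⟨ cong (elt n) (trans (card-upper s (2 * b) refl) (card-+2* 1 b)) ⟩
  elt n (suc b)                   ≡⟨ elt-index {n} {suc b} index≡ (+-comm (2 * b) x) ⟩
  fib (2 * b) * fib x             ≡⟨ *-comm (fib (2 * b)) (fib x) ⟩
  fib x * fib (2 * b)             ∎
  where
  open ≡-Reasoning
  x = suc (2 * s)
  n = x + 2 * b
  halve : ∀ s b → suc (2 * s) + 2 * b ≡ suc (2 * (s + b))
  halve = solve-∀
  n-odd : isOdd n ≡ true
  n-odd = trans (cong isOdd (halve s b)) (isOdd-suc-double (s + b))
  index≡ : index n (suc b) ≡ 2 * b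
  index≡ = index-lower {n} (cc-odd {n} n-odd)
... | odd b = begin
  elt n (card n ∸ s)              ≡⟨ cong (elt n) (trans (card-upper s y refl) (card-+2* 2 b)) ⟩
  elt n (suc (suc b))             ≡⟨ elt-index {n} {suc (suc b)} index≡ (+-comm y x) ⟩
  fib y * fib x                   ≡⟨ *-comm (fib y) (fib x) ⟩
  fib x * fib y                   ∎
  where
  open ≡-Reasoning
  x = suc (2 * s)
  n = x + y
  s≤b : s ≤ b
  s≤b = *-cancelˡ-≤ 2 (s≤s⁻¹ x≤y)
  index≡ : index n (suc (suc b)) ≡ y
  index≡ = index-upper {n} (cc-upper s b s≤b)

-- The m-th smallest product is F_x F_y with x ≤ y and x + y = n: first x = 2t runs upwards
-- through the even numbers (m = t + 1), then x = 2s + 1 runs downwards through the odd ones.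
data Position (n : ℕ) : ℕ → Set where
  lower : ∀ t y → 2 * t + y ≡ n → 2 * t ≤ y → Position n (suc t)
  upper : ∀ s y → suc (2 * s) + y ≡ n → suc (2 * s) ≤ y → Position n (card n ∸ s)

lower-before-upper : ∀ {n t y′ s y} → 2 * t + y′ ≡ n → 2 * t ≤ y′ →
  suc (2 * s) + y ≡ n → suc (2 * s) ≤ y → suc t ≤ card n ∸ s
lower-before-upper {n} {t} {y′} {s} {y} eq′ le′ eq le =
  m+n≤o⇒m≤o∸n (suc t) (<-card (*-cancelˡ-≤ 2 quadruple≤))
  where
  open ≤-Reasoning
  expand : ∀ t s → 2 * (2 * (t + s)) ≡ (2 * t + 2 * t) + (2 * s + 2 * s)
  expand = solve-∀
  2s≤x : 2 * s ≤ suc (2 * s)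
  2s≤x = n≤1+n (2 * s)
  2s≤y : 2 * s ≤ y
  2s≤y = ≤-trans 2s≤x le
  quadruple≤ : 2 * (2 * (t + s)) ≤ 2 * n
  quadruple≤ = begin
    2 * (2 * (t + s))                    ≡⟨ expand t s ⟩
    (2 * t + 2 * t) + (2 * s + 2 * s)    ≤⟨ +-mono-≤ (+-monoʳ-≤ (2 * t) le′) (+-mono-≤ 2s≤x 2s≤y) ⟩
    (2 * t + y′) + (suc (2 * s) + y)     ≡⟨ cong₂ _+_ eq′ eq ⟩
    n + n                                ≡⟨ cong (n +_) (sym (+-identityʳ n)) ⟩
    2 * n                                ∎

position-range : ∀ {n m} → Position n m → 1 ≤ m × m ≤ card n
position-range (lower t y eq le) = s≤s z≤n , <-card (subst (2 * t ≤_) eq (m≤m+n (2 * t) y))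
position-range {n} (upper s y eq le) =
  lower-before-upper {n} {0} {n} {s} refl z≤n eq le , m∸n≤m (card n) s

position-even : ∀ t r → Position (2 * (t + r)) (suc t)
position-even t r with t ≤? r
... | yes t≤r = lower t (2 * r) (sym (*-distribˡ-+ 2 t r)) (*-monoʳ-≤ 2 t≤r)
position-even zero r | no t≰r = contradiction z≤n t≰r
position-even (suc t) r | no t≰r =
  subst (Position _) m≡ (upper r (suc (2 * t)) (split t r) (s≤s (*-monoʳ-≤ 2 r≤t)))
  where
  r≤t : r ≤ t
  r≤t = s≤s⁻¹ (≰⇒> t≰r)
  split : ∀ t r → suc (2 * r) + suc (2 * t) ≡ 2 * (suc t + r)
  split = solve-∀
  m≡ : card (2 * (suc t + r)) ∸ r ≡ suc (suc t)
  m≡ = trans (cong (_∸ r) (card-+2* 0 (suc t + r))) (m+n∸n≡m (suc (suc t)) r)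

position-odd : ∀ t r → Position (suc (2 * (t + r))) (suc t)
position-odd t r with t ≤? r
... | yes t≤r = lower t (suc (2 * r)) (split t r) (≤-trans (*-monoʳ-≤ 2 t≤r) (n≤1+n (2 * r)))
  where
  split : ∀ t r → 2 * t + suc (2 * r) ≡ suc (2 * (t + r))
  split = solve-∀
... | no t≰r = subst (Position _) m≡ (upper r (2 * t) (split t r) (<⇒≤ (odd<even (≰⇒> t≰r))))
  where
  split : ∀ t r → suc (2 * r) + 2 * t ≡ suc (2 * (t + r))
  split = solve-∀
  m≡ : card (suc (2 * (t + r))) ∸ r ≡ suc t
  m≡ = trans (cong (_∸ r) (card-+2* 1 (t + r))) (m+n∸n≡m (suc t) r)

position : ∀ {n m} → 1 ≤ m → m ≤ card n → Position n m
position {n} {suc t} _ m≤card with evenOrOdd n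
... | even p with m≤n⇒∃[o]m+o≡n (s≤s⁻¹ (subst (suc t ≤_) (card-+2* 0 p) m≤card))
...   | r , refl = position-even t r
position {n} {suc t} _ m≤card | odd p
  with m≤n⇒∃[o]m+o≡n (s≤s⁻¹ (subst (suc t ≤_) (card-+2* 1 p) m≤card))
...   | r , refl = position-odd t r

position-mono : ∀ {n m m′} → Position n m → Position n m′ → m < m′ → elt n m < elt n m′
position-mono (lower t y eq le) (lower t′ y′ eq′ le′) (s≤s t<t′) =
  subst₂ _<_ (sym (elt-lower t y eq le)) (sym (elt-lower t′ y′ eq′ le′))
    (fib*-<-even t 2t<2t′ (<-≤-trans 2t<2t′ le′) (trans eq (sym eq′)))
  where
  2t<2t′ : 2 * t < 2 * t′
  2t<2t′ = *-monoʳ-< 2 t<t′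
position-mono (lower t y eq le) (upper s′ y′ eq′ le′) _ with t ≤? s′
... | yes t≤s′ =
  subst₂ _<_ (sym (elt-lower t y eq le)) (sym (elt-upper s′ y′ eq′ le′))
    (fib*-<-even t (even<odd t≤s′) (<-≤-trans (even<odd t≤s′) le′) (trans eq (sym eq′)))
... | no t≰s′ =
  subst₂ _<_ (sym (elt-lower t y eq le)) (sym (elt-upper s′ y′ eq′ le′))
    (fib*-<-odd s′ x′<2t (<-≤-trans x′<2t le) (trans eq′ (sym eq)))
  where
  x′<2t : suc (2 * s′) < 2 * t
  x′<2t = odd<even (≰⇒> t≰s′)
position-mono {n} (upper s y eq le) (lower t′ y′ eq′ le′) m<m′ =
  contradiction (lower-before-upper {n} {t′} {y′} {s} {y} eq′ le′ eq le) (<⇒≱ m<m′)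
position-mono {n} (upper s y eq le) (upper s′ y′ eq′ le′) m<m′ =
  subst₂ _<_ (sym (elt-upper s y eq le)) (sym (elt-upper s′ y′ eq′ le′))
    (fib*-<-odd s′ x′<x (<-≤-trans x′<x le) (trans eq′ (sym eq)))
  where
  x′<x : suc (2 * s′) < suc (2 * s)
  x′<x = s≤s (*-monoʳ-< 2 (∸-cancelʳ-< {s} {s′} {card n} m<m′))

elt-mono : ∀ {n m m′} → 1 ≤ m → m < m′ → m′ ≤ card n → elt n m < elt n m′
elt-mono 1≤m m<m′ m′≤card = position-mono
  (position 1≤m (≤-trans (<⇒≤ m<m′) m′≤card))
  (position (≤-trans 1≤m (<⇒≤ m<m′)) m′≤card)
  m<m′

Enumerated : ℕ → ℕ → Set
Enumerated n x = Σ ℕ λ m → (1 ≤ m) × (m ≤ card n) × (elt n m ≡ x)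

enumerated-at : ∀ {n m x} → Position n m → elt n m ≡ x → Enumerated n x
enumerated-at {m = m} pos e = m , proj₁ (position-range pos) , proj₂ (position-range pos) , e

ordered-pair-enumerated : ∀ {n} i j → i + j ≡ n → i ≤ j → Enumerated n (fib i * fib j)
ordered-pair-enumerated i j eq i≤j with evenOrOdd i
... | even h = enumerated-at (lower h j eq i≤j) (elt-lower h j eq i≤j)
... | odd h = enumerated-at (upper h j eq i≤j) (elt-upper h j eq i≤j)

inProdSet⇒enumerated : ∀ {n x} → InProdSet n x → Enumerated n x
inProdSet⇒enumerated (i , j , eq , refl) with ≤-total i j
... | inj₁ i≤j = ordered-pair-enumerated i j eq i≤j
... | inj₂ j≤i = subst (Enumerated _) (*-comm (fib j) (fib i))
                   (ordered-pair-enumerated j i (trans (+-comm j i) eq) j≤i)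

enumerated⇒inProdSet : ∀ {n x} → Enumerated n x → InProdSet n x
enumerated⇒inProdSet {n} (m , _ , m≤card , refl) =
  index n m , n ∸ index n m , m+[n∸m]≡n (index-≤ m≤card) , refl

lemma2p3 : (n : ℕ) →
    ((x : ℕ) → InProdSet n x ⇔ Σ ℕ (λ m → (1 ≤ m) × (m ≤ card n) × (elt n m ≡ x)))
    × ((m m′ : ℕ) → 1 ≤ m → m < m′ → m′ ≤ card n → elt n m < elt n m′)
lemma2p3 n = (λ x → mk⇔ inProdSet⇒enumerated enumerated⇒inProdSet) , λ m m′ → elt-mono
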